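{- For positive integers $k, t$, we have $b_{kt, t}=k$.
   Context: Let $H_{n,m}=\{0,1,\dots,n-1\}^m$. For $\ell\le m$, an $\ell$-rook is a point $P\in H_{n,m}$ together with a set $D$ of $\ell$ of the $m$ coordinate indices; it attacks every point of $H_{n,m}$ which differs from $P$ in exactly one coordinate, that coordinate belonging to $D$. Distinct rooks must occupy distinct points. $b_{n,m,\ell}$ is the maximum number of $\ell$-rooks that can be placed in $H_{n,m}$ so that no rook attacks the position of another rook, and $b_{m,\ell}=\lim_{n\to\infty} b_{n,m,\ell}/n^{m-1}$ (this limit exists). -}

module Defs where

open import Data.Nat using (ℕ; _≤_; _∸_; _^_; NonZero)
open import Data.Nat.Properties using (m^n≢0)
open import Data.Integer using (+_)
open import Data.Rational using (ℚ; _/_)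
open import Data.Fin using (Fin)
open import Data.Fin.Subset using (Subset; _∈_; ∣_∣)
open import Data.Vec using (Vec; lookup)
open import Data.List using (List; length)
open import Data.List.Relation.Unary.All using (All)
open import Data.List.Relation.Unary.AllPairs using (AllPairs)
open import Data.Product using (Σ; ∃; _×_)
open import Relation.Nullary using (¬_)
open import Relation.Binary.PropositionalEquality using (_≡_; _≢_)

Point : ℕ → ℕ → Set
Point n m = Vec (Fin n) m

record Rook (n m ℓ : ℕ) : Set where
  constructor rook
  field
    pos  : Point n m
    dirs : Subset m
    card : ∣ dirs ∣ ≡ ℓ
open Rook public

Attacks : ∀ {n m ℓ} → Rook n m ℓ → Point n m → Set
Attacks {m = m} r Q =
  ∃ λ (i : Fin m) → (i ∈ dirs r) × (lookup (pos r) i ≢ lookup Q i)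
                   × (∀ (j : Fin m) → j ≢ i → lookup (pos r) j ≡ lookup Q j)

Valid : ∀ {n m ℓ} → List (Rook n m ℓ) → Set
Valid rs = AllPairs (λ r s → pos r ≢ pos s) rs
         × All (λ r → All (λ s → ¬ Attacks r (pos s)) rs) rs

IsMaxRooks : ℕ → ℕ → ℕ → ℕ → Set
IsMaxRooks n m ℓ b =
  (Σ (List (Rook n m ℓ)) λ rs → Valid rs × length rs ≡ b)
  × (∀ (rs : List (Rook n m ℓ)) → Valid rs → length rs ≤ b)

ratio : (b n m : ℕ) → .{{_ : NonZero n}} → ℚ
ratio b n m = _/_ (+ b) (n ^ (m ∸ 1)) {{m^n≢0 n (m ∸ 1)}}

-- Upper bound: among the rooks of a valid placement that attack along coordinate i, a rook is
-- determined by its position with coordinate i deleted, since two rooks with the same projection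
-- would coincide or attack each other.  So at most n^(m-1) rooks attack along each coordinate, and
-- summing over the m coordinates counts every rook ℓ times: ℓ b ≤ m n^(m-1), i.e. b ≤ k n^(kt-1).
--
-- Lower bound: cut the kt coordinates into k blocks of length t, and call a block a codeword when
-- its first letter is the sum mod n of the others, so that two codewords never differ in exactly
-- one letter.  For each block j, put a rook attacking along block j on every position whose j-th
-- block is a codeword and whose other blocks are not.  A position attacked by such a rook has a
-- non-codeword j-th block, so it is not a rook of block j, and it shares with the attacker every
-- other block j′, which is a non-codeword, so it is not a rook of block j′ either.  This gives
-- k n^(t-1) ((n-1) n^(t-1))^(k-1) rooks, and Bernoulli's inequality turns this into
-- n (k n^(kt-1) - b) ≤ k (k-1) n^(kt-1), whence b / n^(kt-1) → k.

module Submission where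

open import Defs
open import Data.Bool using (true; false; if_then_else_)
open import Data.Empty using (⊥-elim)
open import Data.Fin using (Fin; zero; suc; toℕ; combine; punchIn; punchOut; funToFin; finToFun; _≟_)
open import Data.Fin.Properties
  using (combine-injective; combine-surjective; finToFun-funToFin; injective⇒≤; punchIn-injective;
         punchIn-punchOut; punchInᵢ≢i; suc-injective; toℕ-fromℕ<; toℕ-injective; toℕ<n)
open import Data.Fin.Subset using (Subset; inside; outside; _∈_; ⁅_⁆) renaming (∣_∣ to ∣_∣ₛ)
open import Data.Fin.Subset.Properties using (_∈?_; ∣⊤∣≡n; ∣⊥∣≡0; ∣⁅x⁆∣≡1; x∈⁅y⁆⇒x≡y)
open import Data.Integer as ℤ using (+_; +0; +[1+_]; -[1+_])
import Data.Integer.Properties as ℤ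
open import Data.List as List
  using (List; []; _∷_; length; map; filter; cartesianProductWith; cartesianProduct; allFin)
open import Data.List.Membership.Propositional.Properties using (∈-lookup)
open import Data.List.Properties using (length-++; length-map; length-tabulate)
open import Data.List.Relation.Unary.All as All using (All)
import Data.List.Relation.Unary.All.Properties as All
open import Data.List.Relation.Unary.AllPairs as AllPairs using (AllPairs)
import Data.List.Relation.Unary.AllPairs.Properties as AllPairs
open import Data.List.Relation.Unary.Unique.Propositional using (Unique)
import Data.List.Relation.Unary.Unique.Propositional.Properties as Unique
open import Data.Nat as ℕ using (ℕ; zero; suc; _+_; _*_; _∸_; _^_; _≤_; z≤n; s≤s; NonZero)
open import Data.Nat.Coprimality using (Coprime)
open import Data.Nat.DivMod using (_%_; _mod_; %-distribˡ-+; m%n%n≡m%n; [m+n]%n≡m%n; m<n⇒m%n≡m; m%n<n)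
open import Data.Nat.Properties
  using (+-0-commutativeMonoid; +-comm; +-assoc; *-comm; +-mono-≤; +-monoˡ-≤; +-monoʳ-≤; *-assoc; *-zeroʳ;
         *-identityʳ; *-suc; *-monoˡ-≤; *-monoʳ-≤; *-monoˡ-<; *-cancelˡ-≤; *-cancelˡ-<; *-distribˡ-∸; ∸-monoʳ-≤;
         m≤n+o⇒m∸n≤o; ^-monoˡ-≤; ^-distribˡ-+-*; ^-*-assoc; m^n≢0; m≤m+n; n≤1+n; m≤n*m; m+[n∸m]≡n; <⇒≤;
         ≤-trans; module ≤-Reasoning)
open import Data.Nat.Solver using (module +-*-Solver)
open import Data.Product using (∃; _×_; _,_; proj₁; proj₂)
open import Data.Rational using (ℚ; mkℚ; 0ℚ; _<_; _-_; -_; ∣_∣; _/_; toℚᵘ; *<*)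
open import Data.Rational.Properties
  using (toℚᵘ-cancel-<; toℚᵘ-homo-∣-∣; toℚᵘ-homo-+; toℚᵘ-homo‿-; toℚᵘ-fromℚᵘ)
open import Data.Rational.Unnormalised as ℚᵘ using (mkℚᵘ)
import Data.Rational.Unnormalised.Properties as ℚᵘ
open import Data.Vec as Vec using (Vec; []; _∷_; lookup; tabulate; removeAt; insertAt; concat; replicate; _++_)
open import Data.Vec.Properties
  using (∷-injective; ++-injective; tabulate∘lookup; tabulate-cong; removeAt-punchOut; lookup-concat; lookup-map;
         lookup-replicate; insertAt-lookup; insertAt-punchIn; removeAt-insertAt; lookup⇒[]=; []=⇒lookup)
open import Function using (_∘_; _$_; _on_; id)
open import Function.Definitions using (Injective)
open import Relation.Nullary using (¬_; Dec; yes; no; does; contradiction)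
open import Relation.Unary using (Decidable)
open import Relation.Binary.PropositionalEquality

open +-*-Solver
open import Algebra.Properties.CommutativeMonoid.Sum +-0-commutativeMonoid
  using (sum-syntax; ∑-distrib-+; sum-cong-≗)

private variable
  A B C : Set
  d : ℕ

DiffersExactlyAt : Fin d → Vec A d → Vec A d → Set
DiffersExactlyAt i u v = lookup u i ≢ lookup v i × (∀ j → j ≢ i → lookup u j ≡ lookup v j)

Adjacent : Vec A d → Vec A d → Set
Adjacent u v = ∃ λ i → DiffersExactlyAt i u v

lookup-ext : {u v : Vec A d} → (∀ i → lookup u i ≡ lookup v i) → u ≡ v
lookup-ext {u = u} {v} eq = begin
  u                   ≡⟨ tabulate∘lookup u ⟨
  tabulate (lookup u) ≡⟨ tabulate-cong eq ⟩
  tabulate (lookup v) ≡⟨ tabulate∘lookup v ⟩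
  v                   ∎
  where open ≡-Reasoning

removeAt≡⇒lookup≡ : ∀ (u v : Vec A (suc d)) i → removeAt u i ≡ removeAt v i →
                     ∀ j → j ≢ i → lookup u j ≡ lookup v j
removeAt≡⇒lookup≡ u v i eq j j≢i = begin
  lookup u j                           ≡⟨ removeAt-punchOut u i≢j ⟨
  lookup (removeAt u i) (punchOut i≢j) ≡⟨ cong (λ w → lookup w (punchOut i≢j)) eq ⟩
  lookup (removeAt v i) (punchOut i≢j) ≡⟨ removeAt-punchOut v i≢j ⟩
  lookup v j                           ∎
  where
  open ≡-Reasoning
  i≢j = j≢i ∘ sym

module _ {a b : A} {u v : Vec A d} where

  differsAt-zero : DiffersExactlyAt zero (a ∷ u) (b ∷ v) → a ≢ b × u ≡ v
  differsAt-zero (a≢b , agree) = a≢b , lookup-ext (λ j → agree (suc j) λ ())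

  differsAt-suc : ∀ {i} → DiffersExactlyAt (suc i) (a ∷ u) (b ∷ v) → a ≡ b × DiffersExactlyAt i u v
  differsAt-suc (differ , agree) = agree zero (λ ()) , differ , λ j j≢i → agree (suc j) (j≢i ∘ suc-injective)

lookup-injective : {xs : List A} → Unique xs → Injective _≡_ _≡_ (List.lookup xs)
lookup-injective (_ AllPairs.∷ _)    {zero}  {zero}  _  = refl
lookup-injective (x∉xs AllPairs.∷ _) {zero}  {suc j} eq = contradiction eq (All.lookup x∉xs (∈-lookup j))
lookup-injective (x∉xs AllPairs.∷ _) {suc i} {zero}  eq = contradiction (sym eq) (All.lookup x∉xs (∈-lookup i))
lookup-injective (_ AllPairs.∷ xs!)  {suc i} {suc j} eq = cong suc (lookup-injective xs! eq)

unique⇒length≤ : ∀ {M} {f : A → Fin M} → Injective _≡_ _≡_ f → {xs : List A} → Unique xs → length xs ≤ M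
unique⇒length≤ f-inj xs! = injective⇒≤ (lookup-injective xs! ∘ f-inj)

funToFin∘lookup-injective : ∀ {n d} → Injective _≡_ _≡_ (funToFin ∘ lookup {A = Fin n} {n = d})
funToFin∘lookup-injective {x = u} {y = v} eq = lookup-ext λ i → begin
  lookup u i                       ≡⟨ finToFun-funToFin (lookup u) i ⟨
  finToFun (funToFin (lookup u)) i ≡⟨ cong (λ x → finToFun x i) eq ⟩
  finToFun (funToFin (lookup v)) i ≡⟨ finToFun-funToFin (lookup v) i ⟩
  lookup v i                       ∎
  where open ≡-Reasoning

unique-words-length≤ : ∀ {n} {ws : List (Vec (Fin n) d)} → Unique ws → length ws ≤ n ^ d
unique-words-length≤ = unique⇒length≤ funToFin∘lookup-injective

∑-mono-≤ : ∀ {m} {f g : Fin m → ℕ} → (∀ i → f i ≤ g i) → ∑[ i < m ] f i ≤ ∑[ i < m ] g i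
∑-mono-≤ {zero}  f≤g = z≤n
∑-mono-≤ {suc m} f≤g = +-mono-≤ (f≤g zero) (∑-mono-≤ (f≤g ∘ suc))

∑-const : ∀ m c → ∑[ i < m ] c ≡ m * c
∑-const zero    c = refl
∑-const (suc m) c = cong (_+_ c) (∑-const m c)

indicator : ∀ {P : Set} → Dec P → ℕ
indicator P? = if does P? then 1 else 0

length-filter-∷ : ∀ {P : A → Set} (P? : Decidable P) x xs →
                  length (filter P? (x ∷ xs)) ≡ indicator (P? x) + length (filter P? xs)
length-filter-∷ P? x xs with does (P? x)
... | true  = refl
... | false = refl

∑-indicator-∈ : ∀ {m} (p : Subset m) → ∑[ i < m ] indicator (i ∈? p) ≡ ∣ p ∣ₛ
∑-indicator-∈ []            = refl
∑-indicator-∈ (inside ∷ p)  = cong suc (∑-indicator-∈ p)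
∑-indicator-∈ (outside ∷ p) = ∑-indicator-∈ p

all²⇒allPairs : ∀ {R : A → A → Set} {xs} → All (λ x → All (R x) xs) xs → AllPairs R xs
all²⇒allPairs {xs = []}    All.[]                    = AllPairs.[]
all²⇒allPairs {xs = _ ∷ _} ((_ All.∷ Rx) All.∷ Rxs) = Rx AllPairs.∷ all²⇒allPairs (All.map All.tail Rxs)

allPairs-discharge : ∀ {P : A → Set} {R : A → A → Set} {xs} →
                     All P xs → AllPairs (λ x y → P x → R x y) xs → AllPairs R xs
allPairs-discharge All.[]         AllPairs.[]         = AllPairs.[]
allPairs-discharge (px All.∷ pxs) (Rx AllPairs.∷ Rxs) = All.map (_$ px) Rx AllPairs.∷ allPairs-discharge pxs Rxs

module _ {n m ℓ : ℕ} where

  rooksAlong : Fin m → List (Rook n m ℓ) → List (Rook n m ℓ)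
  rooksAlong i = filter (λ r → i ∈? dirs r)

  ∑-length-rooksAlong : ∀ rs → ∑[ i < m ] length (rooksAlong i rs) ≡ ℓ * length rs
  ∑-length-rooksAlong [] = begin
    ∑[ i < m ] 0 ≡⟨ ∑-const m 0 ⟩
    m * 0        ≡⟨ *-zeroʳ m ⟩
    0            ≡⟨ *-zeroʳ ℓ ⟨
    ℓ * 0        ∎
    where open ≡-Reasoning
  ∑-length-rooksAlong (r ∷ rs) = begin
    ∑[ i < m ] length (rooksAlong i (r ∷ rs))
      ≡⟨ sum-cong-≗ (λ i → length-filter-∷ (λ s → i ∈? dirs s) r rs) ⟩
    ∑[ i < m ] (indicator (i ∈? dirs r) + length (rooksAlong i rs))
      ≡⟨ ∑-distrib-+ (λ i → indicator (i ∈? dirs r)) (λ i → length (rooksAlong i rs)) ⟩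
    ∑[ i < m ] indicator (i ∈? dirs r) + ∑[ i < m ] length (rooksAlong i rs)
      ≡⟨ cong₂ _+_ (trans (∑-indicator-∈ (dirs r)) (card r)) (∑-length-rooksAlong rs) ⟩
    ℓ + ℓ * length rs
      ≡⟨ *-suc ℓ (length rs) ⟨
    ℓ * suc (length rs) ∎
    where open ≡-Reasoning

module _ {n m' ℓ : ℕ} where

  nonAttacking⇒removeAt-≢ : ∀ {r s : Rook n (suc m') ℓ} i → pos r ≢ pos s → ¬ Attacks r (pos s) →
                      i ∈ dirs r → removeAt (pos r) i ≢ removeAt (pos s) i
  nonAttacking⇒removeAt-≢ {r} {s} i r≢s ¬r↝s i∈r same with lookup (pos r) i ≟ lookup (pos s) i
  ... | no  differ = ¬r↝s (i , i∈r , differ , removeAt≡⇒lookup≡ (pos r) (pos s) i same)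
  ... | yes agree  = r≢s (lookup-ext agreeAll)
    where
    agreeAll : ∀ j → lookup (pos r) j ≡ lookup (pos s) j
    agreeAll j with j ≟ i
    ... | yes refl = agree
    ... | no  j≢i  = removeAt≡⇒lookup≡ (pos r) (pos s) i same j j≢i

  length-rooksAlong≤ : ∀ {rs} → Valid rs → ∀ i → length (rooksAlong i rs) ≤ n ^ m'
  length-rooksAlong≤ {rs} (distinct , nonAttacking) i = begin
    length (rooksAlong i rs)               ≡⟨ length-map project (rooksAlong i rs) ⟨
    length (map project (rooksAlong i rs)) ≤⟨ unique-words-length≤ (AllPairs.map⁺ projections!) ⟩
    n ^ m'                                 ∎
    where
    open ≤-Reasoning
    project : Rook n (suc m') ℓ → Vec (Fin n) m'
    project r = removeAt (pos r) i
    pairs : AllPairs (λ r s → i ∈ dirs r → project r ≢ project s) rs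
    pairs = AllPairs.map (λ {r} {s} (r≢s , ¬r↝s) → nonAttacking⇒removeAt-≢ {r} {s} i r≢s ¬r↝s)
                         (AllPairs.zip (distinct , all²⇒allPairs nonAttacking))
    projections! : AllPairs (_≢_ on project) (rooksAlong i rs)
    projections! = allPairs-discharge (All.all-filter (λ r → i ∈? dirs r) rs)
                                      (AllPairs.filter⁺ (λ r → i ∈? dirs r) pairs)

  valid⇒ℓ*length≤ : ∀ {rs} → Valid rs → ℓ * length rs ≤ suc m' * n ^ m'
  valid⇒ℓ*length≤ {rs} valid = begin
    ℓ * length rs                            ≡⟨ ∑-length-rooksAlong rs ⟨
    ∑[ i < suc m' ] length (rooksAlong i rs) ≤⟨ ∑-mono-≤ (length-rooksAlong≤ valid) ⟩
    ∑[ i < suc m' ] (n ^ m')                 ≡⟨ ∑-const (suc m') (n ^ m') ⟩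
    suc m' * n ^ m'                          ∎
    where open ≤-Reasoning

valid⇒length≤ : ∀ {n k' t'} {rs : List (Rook n (suc k' * suc t') (suc t'))} →
                Valid rs → length rs ≤ suc k' * n ^ (suc k' * suc t' ∸ 1)
valid⇒length≤ {n} {k'} {t'} {rs} valid = *-cancelˡ-≤ (suc t') (begin
  suc t' * length rs      ≤⟨ valid⇒ℓ*length≤ valid ⟩
  suc k' * suc t' * D     ≡⟨ solve 3 (λ k t D → k :* t :* D := t :* (k :* D)) refl (suc k') (suc t') D ⟩
  suc t' * (suc k' * D)   ∎)
  where
  open ≤-Reasoning
  D = n ^ (suc k' * suc t' ∸ 1)

module _ {n : ℕ} .{{_ : NonZero n}} where

  %-undo-+ : ∀ {a x} → a ℕ.< n → x ≤ n → ((a + x) % n + (n ∸ x)) % n ≡ a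
  %-undo-+ {a} {x} a<n x≤n = begin
    ((a + x) % n + (n ∸ x)) % n         ≡⟨ %-distribˡ-+ ((a + x) % n) (n ∸ x) n ⟩
    ((a + x) % n % n + (n ∸ x) % n) % n ≡⟨ cong (λ y → (y + (n ∸ x) % n) % n) (m%n%n≡m%n (a + x) n) ⟩
    ((a + x) % n + (n ∸ x) % n) % n     ≡⟨ %-distribˡ-+ (a + x) (n ∸ x) n ⟨
    (a + x + (n ∸ x)) % n               ≡⟨ cong (_% n) (+-assoc a x (n ∸ x)) ⟩
    (a + (x + (n ∸ x))) % n             ≡⟨ cong (λ y → (a + y) % n) (m+[n∸m]≡n x≤n) ⟩
    (a + n) % n                         ≡⟨ [m+n]%n≡m%n a n ⟩
    a % n                               ≡⟨ m<n⇒m%n≡m a<n ⟩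
    a                                   ∎
    where open ≡-Reasoning

  +-%-cancelʳ : ∀ {a b x} → a ℕ.< n → b ℕ.< n → x ≤ n → (a + x) % n ≡ (b + x) % n → a ≡ b
  +-%-cancelʳ {a} {b} {x} a<n b<n x≤n eq = begin
    a                           ≡⟨ %-undo-+ a<n x≤n ⟨
    ((a + x) % n + (n ∸ x)) % n ≡⟨ cong (λ y → (y + (n ∸ x)) % n) eq ⟩
    ((b + x) % n + (n ∸ x)) % n ≡⟨ %-undo-+ b<n x≤n ⟩
    b                           ∎
    where open ≡-Reasoning

  infixl 6 _⊕_
  _⊕_ : Fin n → Fin n → Fin n
  a ⊕ b = (toℕ a + toℕ b) mod n

  toℕ-⊕ : ∀ a b → toℕ (a ⊕ b) ≡ (toℕ a + toℕ b) % n
  toℕ-⊕ a b = toℕ-fromℕ< (m%n<n (toℕ a + toℕ b) n)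

  ⊕-comm : ∀ a b → a ⊕ b ≡ b ⊕ a
  ⊕-comm a b = cong (_mod n) (+-comm (toℕ a) (toℕ b))

  ⊕-cancelʳ : ∀ {a b} x → a ⊕ x ≡ b ⊕ x → a ≡ b
  ⊕-cancelʳ {a} {b} x eq = toℕ-injective (+-%-cancelʳ (toℕ<n a) (toℕ<n b) (<⇒≤ (toℕ<n x))
    (trans (sym (toℕ-⊕ a x)) (trans (cong toℕ eq) (toℕ-⊕ b x))))

  ⊕-cancelˡ : ∀ x {a b} → x ⊕ a ≡ x ⊕ b → a ≡ b
  ⊕-cancelˡ x {a} {b} eq = ⊕-cancelʳ x (trans (⊕-comm a x) (trans eq (⊕-comm x b)))

module _ {n' : ℕ} where

  check : ∀ {d} → Vec (Fin (suc n')) d → Fin (suc n')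
  check []      = zero
  check (a ∷ w) = a ⊕ check w

  check-separates-adjacent : ∀ {d} {u v : Vec (Fin (suc n')) d} → Adjacent u v → check u ≢ check v
  check-separates-adjacent {u = a ∷ u} {b ∷ v} (zero , differ) eq with differsAt-zero differ
  ... | a≢b , refl = a≢b (⊕-cancelʳ (check u) eq)
  check-separates-adjacent {u = a ∷ u} {b ∷ v} (suc i , differ) eq with differsAt-suc differ
  ... | refl , differ′ = check-separates-adjacent {u = u} {v} (i , differ′) (⊕-cancelˡ a eq)

  IsCodeword : ∀ {d} → Vec (Fin (suc n')) (suc d) → Set
  IsCodeword (h ∷ w) = h ≡ check w

  codewords-nonAdjacent : ∀ {d} {u v : Vec (Fin (suc n')) (suc d)} →
                          IsCodeword u → IsCodeword v → ¬ Adjacent u v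
  codewords-nonAdjacent {u = _ ∷ u} {_ ∷ v} refl refl (zero , differ) with differsAt-zero differ
  ... | h≢h′ , refl = h≢h′ refl
  codewords-nonAdjacent {u = _ ∷ u} {_ ∷ v} refl refl (suc i , differ) with differsAt-suc differ
  ... | h≡h′ , differ′ = check-separates-adjacent {u = u} {v} (i , differ′) h≡h′

  codeword : ∀ {d} → Vec (Fin (suc n')) d → Vec (Fin (suc n')) (suc d)
  codeword w = check w ∷ w

  -- punchIn skips the check letter, so the words with tail w other than codeword w are indexed by Fin n'.
  nonCodeword : ∀ {d} → Fin n' × Vec (Fin (suc n')) d → Vec (Fin (suc n')) (suc d)
  nonCodeword (a , w) = punchIn (check w) a ∷ w

  nonCodeword-¬IsCodeword : ∀ {d} (p : Fin n' × Vec (Fin (suc n')) d) → ¬ IsCodeword (nonCodeword p)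
  nonCodeword-¬IsCodeword (a , w) = punchInᵢ≢i (check w) a

  nonCodeword-injective : ∀ {d} {p q : Fin n' × Vec (Fin (suc n')) d} → nonCodeword p ≡ nonCodeword q → p ≡ q
  nonCodeword-injective {p = a , w} {b , w′} eq with cong Vec.tail eq
  ... | refl = cong (_, w) (punchIn-injective (check w) a b (cong Vec.head eq))

module _ {t : ℕ} where

  concat-injective : ∀ {m} {X Y : Vec (Vec A t) m} → concat X ≡ concat Y → X ≡ Y
  concat-injective {X = []}    {[]}    _  = refl
  concat-injective {X = x ∷ X} {y ∷ Y} eq with ++-injective x y eq
  ... | refl , eq′ = cong (x ∷_) (concat-injective eq′)

  concat-differsAt : ∀ {m} {X Y : Vec (Vec A t) m} b o →
                     DiffersExactlyAt (combine b o) (concat X) (concat Y) →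
                     DiffersExactlyAt o (lookup X b) (lookup Y b) × (∀ b′ → b′ ≢ b → lookup X b′ ≡ lookup Y b′)
  concat-differsAt {X = X} {Y} b o (differ , agree) =
    (differ ∘ inConcat b o , λ o′ o′≢o → outOfConcat b o′ (o′≢o ∘ proj₂ ∘ combine-injective b o′ b o)) ,
    λ b′ b′≢b → lookup-ext λ o′ → outOfConcat b′ o′ (b′≢b ∘ proj₁ ∘ combine-injective b′ o′ b o)
    where
    inConcat : ∀ b o → lookup (lookup X b) o ≡ lookup (lookup Y b) o →
               lookup (concat X) (combine b o) ≡ lookup (concat Y) (combine b o)
    inConcat b o eq = trans (lookup-concat X b o) (trans eq (sym (lookup-concat Y b o)))
    outOfConcat : ∀ b′ o′ → combine b′ o′ ≢ combine b o → lookup (lookup X b′) o′ ≡ lookup (lookup Y b′) o′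
    outOfConcat b′ o′ ne = trans (sym (lookup-concat X b′ o′)) (trans (agree _ ne) (lookup-concat Y b′ o′))

lookup-insertAt-≢ : ∀ {m} (xs : Vec A m) j v {b} (j≢b : j ≢ b) →
                    lookup (insertAt xs j v) b ≡ lookup xs (punchOut j≢b)
lookup-insertAt-≢ xs j v {b} j≢b = begin
  lookup (insertAt xs j v) b                          ≡⟨ cong (lookup (insertAt xs j v)) (punchIn-punchOut j≢b) ⟨
  lookup (insertAt xs j v) (punchIn j (punchOut j≢b)) ≡⟨ insertAt-punchIn xs j v (punchOut j≢b) ⟩
  lookup xs (punchOut j≢b)                            ∎
  where open ≡-Reasoning

∣++∣ : ∀ {a b} (p : Subset a) (q : Subset b) → ∣ p ++ q ∣ₛ ≡ ∣ p ∣ₛ + ∣ q ∣ₛ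
∣++∣ []            q = refl
∣++∣ (inside ∷ p)  q = cong suc (∣++∣ p q)
∣++∣ (outside ∷ p) q = ∣++∣ p q

∣concat-map-replicate∣ : ∀ t {m} (p : Subset m) → ∣ concat (Vec.map (replicate t) p) ∣ₛ ≡ t * ∣ p ∣ₛ
∣concat-map-replicate∣ t []            = sym (*-zeroʳ t)
∣concat-map-replicate∣ t (inside ∷ p)  = begin
  ∣ replicate t inside ++ rest ∣ₛ     ≡⟨ ∣++∣ (replicate t inside) rest ⟩
  ∣ replicate t inside ∣ₛ + ∣ rest ∣ₛ ≡⟨ cong₂ _+_ (∣⊤∣≡n t) (∣concat-map-replicate∣ t p) ⟩
  t + t * ∣ p ∣ₛ                      ≡⟨ *-suc t ∣ p ∣ₛ ⟨
  t * suc ∣ p ∣ₛ                      ∎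
  where
  open ≡-Reasoning
  rest = concat (Vec.map (replicate t) p)
∣concat-map-replicate∣ t (outside ∷ p) = begin
  ∣ replicate t outside ++ rest ∣ₛ     ≡⟨ ∣++∣ (replicate t outside) rest ⟩
  ∣ replicate t outside ∣ₛ + ∣ rest ∣ₛ ≡⟨ cong₂ _+_ (∣⊥∣≡0 t) (∣concat-map-replicate∣ t p) ⟩
  t * ∣ p ∣ₛ                           ∎
  where
  open ≡-Reasoning
  rest = concat (Vec.map (replicate t) p)

blockDirs : ∀ {K} t → Fin K → Subset (K * t)
blockDirs t j = concat (Vec.map (replicate t) ⁅ j ⁆)

∣blockDirs∣ : ∀ {K} t (j : Fin K) → ∣ blockDirs t j ∣ₛ ≡ t
∣blockDirs∣ t j = trans (∣concat-map-replicate∣ t ⁅ j ⁆) (trans (cong (t *_) (∣⁅x⁆∣≡1 j)) (*-identityʳ t))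

∈blockDirs⇒ : ∀ {K t} {j b : Fin K} {o : Fin t} → combine b o ∈ blockDirs t j → b ≡ j
∈blockDirs⇒ {t = t} {j} {b} {o} b∈j = x∈⁅y⁆⇒x≡y j (lookup⇒[]= b ⁅ j ⁆ (begin
  lookup ⁅ j ⁆ b                                  ≡⟨ lookup-replicate o (lookup ⁅ j ⁆ b) ⟨
  lookup (replicate t (lookup ⁅ j ⁆ b)) o         ≡⟨ cong (λ x → lookup x o) (lookup-map b (replicate t) ⁅ j ⁆) ⟨
  lookup (lookup (Vec.map (replicate t) ⁅ j ⁆) b) o ≡⟨ lookup-concat (Vec.map (replicate t) ⁅ j ⁆) b o ⟨
  lookup (blockDirs t j) (combine b o)            ≡⟨ []=⇒lookup b∈j ⟩
  inside                                          ∎))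
  where open ≡-Reasoning

map-injective : ∀ {f : A → B} → Injective _≡_ _≡_ f → ∀ {m} → Injective _≡_ _≡_ (Vec.map {n = m} f)
map-injective f-inj {x = []}    {[]}    _  = refl
map-injective f-inj {x = x ∷ X} {y ∷ Y} eq with ∷-injective eq
... | fx≡fy , eq′ = cong₂ _∷_ (f-inj fx≡fy) (map-injective f-inj eq′)

length-allFin : ∀ m → length (allFin m) ≡ m
length-allFin m = length-tabulate {n = m} id

length-cartesianProductWith : ∀ (f : A → B → C) xs ys →
                              length (cartesianProductWith f xs ys) ≡ length xs * length ys
length-cartesianProductWith f []       ys = refl
length-cartesianProductWith f (x ∷ xs) ys = trans (length-++ (map (f x) ys))
  (cong₂ _+_ (length-map (f x) ys) (length-cartesianProductWith f xs ys))

vectorsOver : List A → ∀ d → List (Vec A d)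
vectorsOver xs zero    = [] ∷ []
vectorsOver xs (suc d) = cartesianProductWith _∷_ xs (vectorsOver xs d)

vectorsOver-unique : ∀ {xs : List A} d → Unique xs → Unique (vectorsOver xs d)
vectorsOver-unique zero    xs! = All.[] AllPairs.∷ AllPairs.[]
vectorsOver-unique (suc d) xs! = Unique.cartesianProductWith⁺ _∷_ ∷-injective xs! (vectorsOver-unique d xs!)

length-vectorsOver : ∀ (xs : List A) d → length (vectorsOver xs d) ≡ length xs ^ d
length-vectorsOver xs zero    = refl
length-vectorsOver xs (suc d) = trans (length-cartesianProductWith _∷_ xs (vectorsOver xs d))
  (cong (length xs *_) (length-vectorsOver xs d))

module Placement (n' k' t' : ℕ) where

  private
    n K t : ℕ
    n = suc n'
    K = suc k'
    t = suc t'

  -- (j , w , ps) is the rook attacking along block j whose j-th block is codeword w and whose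
  -- other blocks are the non-codewords ps.
  RookData : Set
  RookData = Fin K × Vec (Fin n) t' × Vec (Fin n' × Vec (Fin n) t') k'

  direction : RookData → Fin K
  direction (j , _) = j

  blocks : RookData → Vec (Vec (Fin n) t) K
  blocks (j , w , ps) = insertAt (Vec.map nonCodeword ps) j (codeword w)

  blocks-codeword : ∀ d → IsCodeword (lookup (blocks d) (direction d))
  blocks-codeword (j , w , ps) rewrite insertAt-lookup (Vec.map nonCodeword ps) j (codeword w) = refl

  codewordBlock-unique : ∀ d b → IsCodeword (lookup (blocks d) b) → b ≡ direction d
  codewordBlock-unique (j , w , ps) b isCodeword with b ≟ j
  ... | yes b≡j = b≡j
  ... | no  b≢j = ⊥-elim (nonCodeword-¬IsCodeword (lookup ps (punchOut j≢b))
      (subst IsCodeword (trans (lookup-insertAt-≢ _ j _ j≢b) (lookup-map _ nonCodeword ps)) isCodeword))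
    where j≢b = b≢j ∘ sym

  toRook : RookData → Rook n (K * t) t
  toRook d = rook (concat (blocks d)) (blockDirs t (direction d)) (∣blockDirs∣ t (direction d))

  toRook-nonAttacking : ∀ d e → ¬ Attacks (toRook d) (pos (toRook e))
  toRook-nonAttacking d@(j , _) e@(j′ , _) (i , i∈dirs , differs)
    with combine-surjective {K} {t} i
  ... | b , o , refl with ∈blockDirs⇒ {j = j} {b} {o} i∈dirs
  ... | refl with concat-differsAt {X = blocks d} {blocks e} b o differs
  ... | adjacent , agree with j′ ≟ j
  ... | yes refl = codewords-nonAdjacent (blocks-codeword d) (blocks-codeword e) (o , adjacent)
  ... | no  j′≢j = j′≢j (codewordBlock-unique d j′
                          (subst IsCodeword (sym (agree j′ j′≢j)) (blocks-codeword e)))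

  toRook-pos-injective : ∀ {d e} → pos (toRook d) ≡ pos (toRook e) → d ≡ e
  toRook-pos-injective {d@(j , w , ps)} {e@(j′ , w′ , ps′)} eq with concat-injective {X = blocks d} {blocks e} eq
  ... | same with codewordBlock-unique e j (subst IsCodeword (cong (λ X → lookup X j) same) (blocks-codeword d))
  ... | refl = cong₂ (λ w ps → j , w , ps) (cong Vec.tail sameCodeword)
                     (map-injective nonCodeword-injective sameNonCodewords)
    where
    sameCodeword : codeword w ≡ codeword w′
    sameCodeword = begin
      codeword w          ≡⟨ insertAt-lookup (Vec.map nonCodeword ps) j (codeword w) ⟨
      lookup (blocks d) j ≡⟨ cong (λ X → lookup X j) same ⟩
      lookup (blocks e) j ≡⟨ insertAt-lookup (Vec.map nonCodeword ps′) j (codeword w′) ⟩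
      codeword w′         ∎
      where open ≡-Reasoning
    sameNonCodewords : Vec.map nonCodeword ps ≡ Vec.map nonCodeword ps′
    sameNonCodewords = begin
      Vec.map nonCodeword ps ≡⟨ removeAt-insertAt (Vec.map nonCodeword ps) j (codeword w) ⟨
      removeAt (blocks d) j  ≡⟨ cong (λ X → removeAt X j) same ⟩
      removeAt (blocks e) j  ≡⟨ removeAt-insertAt (Vec.map nonCodeword ps′) j (codeword w′) ⟩
      Vec.map nonCodeword ps′ ∎
      where open ≡-Reasoning

  allRookData : List RookData
  allRookData = cartesianProduct (allFin K) (cartesianProduct (vectorsOver (allFin n) t')
                  (vectorsOver (cartesianProduct (allFin n') (vectorsOver (allFin n) t')) k'))

  allRookData-unique : Unique allRookData
  allRookData-unique = Unique.cartesianProduct⁺ (Unique.allFin⁺ K) (Unique.cartesianProduct⁺ words!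
    (vectorsOver-unique k' (Unique.cartesianProduct⁺ (Unique.allFin⁺ n') words!)))
    where words! = vectorsOver-unique t' (Unique.allFin⁺ n)

  length-allRookData : length allRookData ≡ K * (n ^ t' * (n' * n ^ t') ^ k')
  length-allRookData = begin
    length allRookData
      ≡⟨ length-cartesianProductWith _,_ (allFin K) (cartesianProduct words nonCodewords) ⟩
    length (allFin K) * length (cartesianProduct words nonCodewords)
      ≡⟨ cong₂ _*_ (length-allFin K) (length-cartesianProductWith _,_ words nonCodewords) ⟩
    K * (length words * length nonCodewords)
      ≡⟨ cong (K *_) (cong₂ _*_ length-words (length-vectorsOver _ k')) ⟩
    K * (n ^ t' * length (cartesianProduct (allFin n') words) ^ k')
      ≡⟨ cong (λ x → K * (n ^ t' * x ^ k')) (length-cartesianProductWith _,_ (allFin n') words) ⟩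
    K * (n ^ t' * (length (allFin n') * length words) ^ k')
      ≡⟨ cong (λ x → K * (n ^ t' * x ^ k')) (cong₂ _*_ (length-allFin n') length-words) ⟩
    K * (n ^ t' * (n' * n ^ t') ^ k') ∎
    where
    open ≡-Reasoning
    words = vectorsOver (allFin n) t'
    nonCodewords = vectorsOver (cartesianProduct (allFin n') words) k'
    length-words : length words ≡ n ^ t'
    length-words = trans (length-vectorsOver (allFin n) t') (cong (_^ t') (length-allFin n))

  placement : List (Rook n (K * t) t)
  placement = map toRook allRookData

  placement-valid : Valid placement
  placement-valid =
    AllPairs.map⁺ (AllPairs.map (_∘ toRook-pos-injective) allRookData-unique) ,
    All.map⁺ (All.universal (λ d → All.map⁺ (All.universal (toRook-nonAttacking d) allRookData)) allRookData)

  length-placement : length placement ≡ K * (n ^ t' * (n' * n ^ t') ^ k')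
  length-placement = trans (length-map toRook allRookData) length-allRookData

bernoulli : ∀ m x j → suc m * (suc m * x) ^ j ≤ suc m * (m * x) ^ j + j * (suc m * x) ^ j
bernoulli m x zero    = m≤m+n (suc m * 1) 0
bernoulli m x (suc j) = begin
  n * (n * x * N)                             ≡⟨ solve 3 (λ n x N → n :* (n :* x :* N) := n :* x :* (n :* N))
                                                   refl n x N ⟩
  n * x * (n * N)                             ≤⟨ *-monoʳ-≤ (n * x) (bernoulli m x j) ⟩
  n * x * (n * M + j * N)                     ≡⟨ solve 5 (λ m x M N j → let n = con 1 :+ m in
                                                    n :* x :* (n :* M :+ j :* N) :=
                                                    n :* (m :* x :* M) :+ n :* x :* M :+ j :* (n :* x :* N))
                                                   refl m x M N j ⟩
  n * (m * x * M) + n * x * M + j * (n * x * N) ≤⟨ +-monoˡ-≤ (j * (n * x * N))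
                                                   (+-monoʳ-≤ (n * (m * x * M)) (*-monoʳ-≤ (n * x) M≤N)) ⟩
  n * (m * x * M) + n * x * N + j * (n * x * N) ≡⟨ +-assoc (n * (m * x * M)) _ _ ⟩
  n * (m * x * M) + suc j * (n * x * N)       ∎
  where
  open ≤-Reasoning
  n = suc m
  M = (m * x) ^ j
  N = (n * x) ^ j
  M≤N : M ≤ N
  M≤N = ^-monoˡ-≤ j (*-monoˡ-≤ x (n≤1+n m))

deficit-bound : ∀ n' k' A {b} → suc k' * (A * (n' * A) ^ k') ≤ b →
                suc n' * (suc k' * (A * (suc n' * A) ^ k') ∸ b) ≤ suc k' * k' * (A * (suc n' * A) ^ k')
deficit-bound n' k' A {b} N≤b = begin
  n * (K * D ∸ b)   ≤⟨ *-monoʳ-≤ n (∸-monoʳ-≤ (K * D) N≤b) ⟩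
  n * (K * D ∸ N)   ≡⟨ *-distribˡ-∸ n (K * D) N ⟩
  n * (K * D) ∸ n * N ≤⟨ m≤n+o⇒m∸n≤o (n * (K * D)) (n * N) nKD≤nN+Kk'D ⟩
  K * k' * D        ∎
  where
  open ≤-Reasoning
  n = suc n'
  K = suc k'
  P = (n * A) ^ k'
  Q = (n' * A) ^ k'
  D = A * P
  N = K * (A * Q)
  nKD≤nN+Kk'D : n * (K * D) ≤ n * N + K * k' * D
  nKD≤nN+Kk'D = begin
    n * (K * (A * P))         ≡⟨ solve 4 (λ n K A P → n :* (K :* (A :* P)) := K :* A :* (n :* P)) refl n K A P ⟩
    K * A * (n * P)           ≤⟨ *-monoʳ-≤ (K * A) (bernoulli n' A k') ⟩
    K * A * (n * Q + k' * P)  ≡⟨ solve 6 (λ n K A P Q k → K :* A :* (n :* Q :+ k :* P) :=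
                                                        n :* (K :* (A :* Q)) :+ K :* k :* (A :* P))
                                   refl n K A P Q k' ⟩
    n * (K * (A * Q)) + K * k' * (A * P) ∎

n*a≤c*D⇒a*q<D : ∀ {n a c q D} .{{_ : NonZero D}} → n * a ≤ c * D → c * q ℕ.< n → a * q ℕ.< D
n*a≤c*D⇒a*q<D {n} {a} {c} {q} {D} na≤cD cq<n = *-cancelˡ-< n (a * q) D (begin-strict
  n * (a * q) ≡⟨ *-assoc n a q ⟨
  n * a * q   ≤⟨ *-monoˡ-≤ q na≤cD ⟩
  c * D * q   ≡⟨ solve 3 (λ c D q → c :* D :* q := c :* q :* D) refl c D q ⟩
  c * q * D   <⟨ *-monoˡ-< D cq<n ⟩
  n * D       ∎)
  where open ≤-Reasoning

toℚᵘ-/ : ∀ i D .{{_ : NonZero D}} → toℚᵘ (i / D) ℚᵘ.≃ mkℚᵘ i (ℕ.pred D)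
toℚᵘ-/ i (suc D-1) = toℚᵘ-fromℚᵘ (mkℚᵘ i D-1)

∣b*1-k*D∣ : ∀ b k D → b ≤ k * D → ℤ.∣ + b ℤ.* + 1 ℤ.+ ℤ.- (+ k) ℤ.* + D ∣ ≡ k * D ∸ b
∣b*1-k*D∣ b k D b≤kD = begin
  ℤ.∣ + b ℤ.* + 1 ℤ.+ ℤ.- (+ k) ℤ.* + D ∣ ≡⟨ cong ℤ.∣_∣ (cong₂ ℤ._+_ (ℤ.*-identityʳ (+ b)) -k*D≡-[k*D]) ⟩
  ℤ.∣ + b ℤ.+ ℤ.- + (k * D) ∣             ≡⟨ cong ℤ.∣_∣ (trans (ℤ.+-comm (+ b) (ℤ.- + (k * D))) (ℤ.-m+n≡n⊖m (k * D) b)) ⟩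
  ℤ.∣ b ℤ.⊖ k * D ∣                         ≡⟨ ℤ.∣⊖∣-≤ b≤kD ⟩
  k * D ∸ b                                 ∎
  where
  open ≡-Reasoning
  -k*D≡-[k*D] : ℤ.- (+ k) ℤ.* + D ≡ ℤ.- + (k * D)
  -k*D≡-[k*D] = trans (sym (ℤ.neg-distribˡ-* (+ k) (+ D))) (cong ℤ.-_ (sym (ℤ.pos-* k D)))

∣b/D-k∣<ε : ∀ b k D .{{_ : NonZero D}} p q .(c : Coprime (suc p) (suc q)) →
            b ≤ k * D → (k * D ∸ b) * suc q ℕ.< suc p * D →
            ∣ + b / D - + k / 1 ∣ < mkℚ +[1+ p ] q c
∣b/D-k∣<ε b k (suc D-1) p q c b≤kD deficit = toℚᵘ-cancel-< (ℚᵘ.<-respˡ-≃ (ℚᵘ.≃-sym toℚᵘ-distance) unnormalised)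
  where
  x = + b / suc D-1
  y = + k / 1
  toℚᵘ-distance : toℚᵘ ∣ x - y ∣ ℚᵘ.≃ ℚᵘ.∣ mkℚᵘ (+ b) D-1 ℚᵘ.- mkℚᵘ (+ k) 0 ∣
  toℚᵘ-distance = ℚᵘ.≃-trans (toℚᵘ-homo-∣-∣ (x - y)) (ℚᵘ.∣-∣-cong (ℚᵘ.≃-trans (toℚᵘ-homo-+ x (- y))
    (ℚᵘ.+-cong (toℚᵘ-/ (+ b) (suc D-1)) (ℚᵘ.≃-trans (toℚᵘ-homo‿- y) (ℚᵘ.-‿cong (toℚᵘ-/ (+ k) 1))))))
  unnormalised : ℚᵘ.∣ mkℚᵘ (+ b) D-1 ℚᵘ.- mkℚᵘ (+ k) 0 ∣ ℚᵘ.< mkℚᵘ +[1+ p ] q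
  unnormalised = ℚᵘ.*<* (subst₂ ℤ._<_ numerator denominator (ℤ.+<+ deficit))
    where
    numerator : + ((k * suc D-1 ∸ b) * suc q) ≡ + ℤ.∣ + b ℤ.* + 1 ℤ.+ ℤ.- (+ k) ℤ.* + suc D-1 ∣ ℤ.* + suc q
    numerator = trans (ℤ.pos-* (k * suc D-1 ∸ b) (suc q))
                      (cong (λ z → + z ℤ.* + suc q) (sym (∣b*1-k*D∣ b k (suc D-1) b≤kD)))
    denominator : + (suc p * suc D-1) ≡ +[1+ p ] ℤ.* + suc (D-1 * 1)
    denominator = trans (cong (λ z → + (suc p * suc z)) (sym (*-identityʳ D-1))) (ℤ.pos-* (suc p) (suc (D-1 * 1)))

^-split : ∀ n k' t' → n ^ (suc k' * suc t' ∸ 1) ≡ n ^ t' * (n * n ^ t') ^ k'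
^-split n k' t' = begin
  -- suc k' * suc t' ∸ 1 reduces to t' + k' * suc t'
  n ^ (t' + k' * suc t')     ≡⟨ ^-distribˡ-+-* n t' (k' * suc t') ⟩
  n ^ t' * n ^ (k' * suc t') ≡⟨ cong (λ e → n ^ t' * n ^ e) (*-comm k' (suc t')) ⟩
  n ^ t' * n ^ (suc t' * k') ≡⟨ cong (n ^ t' *_) (^-*-assoc n (suc t') k') ⟨
  n ^ t' * (n ^ suc t') ^ k' ∎
  where open ≡-Reasoning

maxRooks-deficit : ∀ n' k' t' {b} → IsMaxRooks (suc n') (suc k' * suc t') (suc t') b →
                   let D = suc n' ^ (suc k' * suc t' ∸ 1) in
                   suc n' * (suc k' * D ∸ b) ≤ suc k' * k' * D
maxRooks-deficit n' k' t' {b} (_ , maximal) =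
  subst (λ D → suc n' * (suc k' * D ∸ b) ≤ suc k' * k' * D) (sym (^-split (suc n') k' t'))
        (deficit-bound n' k' (suc n' ^ t') placement≤b)
  where
  open Placement n' k' t'
  placement≤b : suc k' * (suc n' ^ t' * (n' * suc n' ^ t') ^ k') ≤ b
  placement≤b = subst (_≤ b) length-placement (maximal placement placement-valid)

theorem18 : (k t : ℕ) → .{{_ : NonZero k}} → .{{_ : NonZero t}} →
    (ε : ℚ) → 0ℚ < ε →
    ∃ λ (N : ℕ) → (n : ℕ) → N ≤ n → .{{_ : NonZero n}} →
      (b : ℕ) → IsMaxRooks n (k * t) t b →
      ∣ ratio b n (k * t) - (+ k / 1) ∣ < ε
theorem18 zero     _        _                  _                     = ⊥-elim (ℕ.≢-nonZero⁻¹ 0 refl)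
theorem18 (suc k') zero     _                  _                     = ⊥-elim (ℕ.≢-nonZero⁻¹ 0 refl)
theorem18 (suc k') (suc t') (mkℚ +0       _ _) (*<* (ℤ.+<+ ()))
theorem18 (suc k') (suc t') (mkℚ -[1+ _ ] _ _) (*<* ())
-- The threshold comes from n (k D ∸ b) ≤ k (k - 1) D, where D = n ^ (k t ∸ 1).
theorem18 (suc k') (suc t') (mkℚ +[1+ p ] q c) _ = suc (suc k' * k' * suc q) , close
  where
  close : (n : ℕ) → suc (suc k' * k' * suc q) ≤ n → .{{_ : NonZero n}} →
          (b : ℕ) → IsMaxRooks n (suc k' * suc t') (suc t') b →
          ∣ ratio b n (suc k' * suc t') - (+ suc k' / 1) ∣ < mkℚ +[1+ p ] q c
  close (suc n') (s≤s Kk'[1+q]≤n') b maxRooks@((_ , valid , length≡b) , _) =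
    ∣b/D-k∣<ε b (suc k') D p q c b≤kD (≤-trans deficit<D (m≤n*m D (suc p)))
    where
    D = suc n' ^ (suc k' * suc t' ∸ 1)
    instance _ = m^n≢0 (suc n') (suc k' * suc t' ∸ 1)
    b≤kD : b ≤ suc k' * D
    b≤kD = subst (_≤ suc k' * D) length≡b (valid⇒length≤ {k' = k'} {t'} valid)
    deficit<D : (suc k' * D ∸ b) * suc q ℕ.< D
    deficit<D = n*a≤c*D⇒a*q<D {c = suc k' * k'} (maxRooks-deficit n' k' t' maxRooks) (s≤s Kk'[1+q]≤n')
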